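{- Let $S=\{s_1<s_2<\cdots\}$ be an infinite subset of $\mathbb{N}$, enumerated increasingly. If $\sum_{i=1}^n s_{k_i}\notin S$ for every integer $n\ge2$ and all $1\le k_1<\cdots<k_n$, then $\mathbb{N}\setminus S$ is an IP$_{<\omega}$*-set in $\mathbb{N}$.
   Context: $\mathbb{N}=\{1,2,\dots\}$. For $x_1,\dots,x_n\in\mathbb{N}$, $FS((x_t)_{t=1}^n)=\{\sum_{t\in\alpha}x_t:\emptyset\ne\alpha\subset\{1,\dots,n\}\}$. $A\subset\mathbb{N}$ is an IP$_{<\omega}$-set if whenever $\mathcal{F}$ is a finite partition of $A$ and $n\in\mathbb{N}$, there exist $F\in\mathcal{F}$ and $x_1,\dots,x_n\in\mathbb{N}$ with $FS((x_t)_{t=1}^n)\subset F$. $B$ is an IP$_{<\omega}$*-set if $B\cap A\ne\emptyset$ for every IP$_{<\omega}$-set $A$. -}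

module Defs where

open import Data.Nat using (ℕ; zero; suc; _+_; _≤_; _<_)
open import Data.Bool using (true; false)
open import Data.Fin using (Fin)
import Data.Fin as Fin
open import Data.Fin.Subset using (Subset; Nonempty)
open import Data.Vec using ([]; _∷_)
open import Data.Product using (Σ; ∃; _×_)
open import Relation.Nullary using (¬_)
open import Data.Empty using (⊥)
open import Relation.Binary.PropositionalEquality using (_≡_)

-- Subsets of ℕ = {1,2,...} are modelled as predicates on Agda's ℕ;
-- positivity is imposed explicitly where needed.
Pred : Set₁
Pred = ℕ → Set

sumF : ∀ {n} → (Fin n → ℕ) → ℕ
sumF {zero}  x = 0
sumF {suc n} x = x Fin.zero + sumF (λ t → x (Fin.suc t))

subsetSum : ∀ {n} → Subset n → (Fin n → ℕ) → ℕ
subsetSum {zero}  []          x = 0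
subsetSum {suc n} (true  ∷ α) x = x Fin.zero + subsetSum α (λ t → x (Fin.suc t))
subsetSum {suc n} (false ∷ α) x = subsetSum α (λ t → x (Fin.suc t))

FS⊆ : ∀ {n} → (Fin n → ℕ) → Pred → Set
FS⊆ {n} x F = (α : Subset n) → Nonempty α → F (subsetSum α x)

-- IP_{<ω}-set A ⊆ ℕ: every finite partition of A (given as a colouring
-- c : ℕ → Fin r, the cells being {a ∈ A : c a ≡ i}) and every n admit a
-- cell F and positive x_1..x_n with FS(x) ⊆ F.
IP<ω : Pred → Set
IP<ω A = (r : ℕ) (c : ℕ → Fin r) (n : ℕ) →
  Σ (Fin r) λ i → Σ (Fin n → ℕ) λ x →
    (∀ t → 1 ≤ x t) × FS⊆ x (λ m → A m × c m ≡ i)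

IP<ω* : Pred → Set₁
IP<ω* B = (A : Pred) → (∀ a → A a → 1 ≤ a) → IP<ω A →
  ¬ (∀ a → A a → B a → ⊥)


Range : (ℕ → ℕ) → Pred
Range s m = ∃ λ i → s i ≡ m

StrictlyIncreasing : (ℕ → ℕ) → Set
StrictlyIncreasing s = ∀ {i j} → i < j → s i < s j

{-# OPTIONS --safe #-}
module Submission where

-- Taking two terms, the range S of s contains no a + b with a ≠ b both in S.
-- Suppose an IP_{<ω}-set A were contained in S. The trivial partition gives
-- positive x₀, x₁, x₂ with all their finite sums in A. If x₀ ≠ x₁, then x₀, x₁
-- and x₀ + x₁ lie in S; otherwise x₀ < x₁ + x₂, and x₀, x₁ + x₂ and
-- x₀ + x₁ + x₂ lie in S.

open import Defs
open import Data.Nat using (ℕ; _≤_; _<_; _+_; z≤n; s≤s; _≟_)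
open import Data.Nat.Properties using (<-cmp; +-comm; +-identityʳ; m<m+n; <⇒≢)
open import Data.Fin using (Fin; zero; suc)
import Data.Fin as Fin
open import Data.Bool using (true; false)
open import Data.Vec using ([]; _∷_; here; there)
open import Data.Fin.Subset using (Subset; Nonempty)
open import Data.Product using (_,_; proj₁)
open import Data.Empty using (⊥)
open import Function using (_∘′_)
open import Relation.Nullary using (¬_; Dec; yes; no)
open import Relation.Binary using (tri<; tri≈; tri>)
open import Relation.Binary.PropositionalEquality using (_≡_; _≢_; refl; sym; cong; subst)

DistinctSumFree : Pred → Set
DistinctSumFree P = ∀ {a b} → P a → P b → a ≢ b → ¬ P (a + b)

¬¬-distinctSumFree : ∀ {P} → DistinctSumFree P → DistinctSumFree (λ m → ¬ ¬ P m)
¬¬-distinctSumFree free ¬¬Pa ¬¬Pb a≢b ¬¬Pa+b =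
  ¬¬Pa λ Pa → ¬¬Pb λ Pb → ¬¬Pa+b (free Pa Pb a≢b)

distinctSumFree⇒¬FS⊆ : ∀ {P} → DistinctSumFree P →
  (x : Fin 3 → ℕ) → (∀ t → 1 ≤ x t) → ¬ FS⊆ x P
distinctSumFree⇒¬FS⊆ {P} free x x>0 fs = split (x₀ ≟ x₁)
  where
  x₀ x₁ x₂ : ℕ
  x₀ = x zero
  x₁ = x (suc zero)
  x₂ = x (suc (suc zero))

  in-FS : (α : Subset 3) → Nonempty α → ∀ {m} → subsetSum α x ≡ m → P m
  in-FS α α≠∅ eq = subst P eq (fs α α≠∅)

  P-x₀ : P x₀
  P-x₀ = in-FS (true ∷ false ∷ false ∷ []) (zero , here) (+-identityʳ x₀)
  P-x₁ : P x₁
  P-x₁ = in-FS (false ∷ true ∷ false ∷ []) (suc zero , there here) (+-identityʳ x₁)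
  P-x₀+x₁ : P (x₀ + x₁)
  P-x₀+x₁ = in-FS (true ∷ true ∷ false ∷ []) (zero , here) (cong (x₀ +_) (+-identityʳ x₁))
  P-x₁+x₂ : P (x₁ + x₂)
  P-x₁+x₂ = in-FS (false ∷ true ∷ true ∷ []) (suc zero , there here) (cong (x₁ +_) (+-identityʳ x₂))
  P-x₀+x₁+x₂ : P (x₀ + (x₁ + x₂))
  P-x₀+x₁+x₂ = in-FS (true ∷ true ∷ true ∷ []) (zero , here)
    (cong (λ y → x₀ + (x₁ + y)) (+-identityʳ x₂))

  split : Dec (x₀ ≡ x₁) → ⊥
  split (no x₀≢x₁)  = free P-x₀ P-x₁ x₀≢x₁ P-x₀+x₁
  split (yes x₀≡x₁) = free P-x₀ P-x₁+x₂ (<⇒≢ x₀<x₁+x₂) P-x₀+x₁+x₂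
    where
    x₀<x₁+x₂ : x₀ < x₁ + x₂
    x₀<x₁+x₂ = subst (_< x₁ + x₂) (sym x₀≡x₁) (m<m+n x₁ (x>0 (suc (suc zero))))

distinctSumFree⇒∁-IP<ω* : ∀ {P} → DistinctSumFree P → IP<ω* (λ m → ¬ P m)
distinctSumFree⇒∁-IP<ω* free A _ A-IP A∩∁P≡∅ with A-IP 1 (λ _ → zero) 3
... | _ , x , x>0 , FS⊆A =
  distinctSumFree⇒¬FS⊆ (¬¬-distinctSumFree free) x x>0 λ α α≠∅ →
    A∩∁P≡∅ _ (proj₁ (FS⊆A α α≠∅))

pairSumsOfTerms∉Range : (s : ℕ → ℕ) →
  ((n : ℕ) → 2 ≤ n → (k : Fin n → ℕ) → (∀ {a b} → a Fin.< b → k a < k b) →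
    ¬ Range s (sumF (λ t → s (k t)))) →
  ∀ {i j} → i < j → ¬ Range s (s i + s j)
pairSumsOfTerms∉Range s sums∉Range {i} {j} i<j =
  sums∉Range 2 (s≤s (s≤s z≤n)) k k-increasing
    ∘′ subst (Range s) (cong (s i +_) (sym (+-identityʳ (s j))))
  where
  k : Fin 2 → ℕ
  k zero    = i
  k (suc _) = j
  k-increasing : ∀ {a b} → a Fin.< b → k a < k b
  k-increasing {zero}     {suc zero} _ = i<j
  k-increasing {suc zero} {suc zero} (s≤s ())

range-distinctSumFree : (s : ℕ → ℕ) → (∀ {i j} → i < j → ¬ Range s (s i + s j)) →
  DistinctSumFree (Range s)
range-distinctSumFree s pairSums∉Range (i , refl) (j , refl) si≢sj with <-cmp i j
... | tri< i<j _ _ = pairSums∉Range i<j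
... | tri≈ _ i≡j _ = λ _ → si≢sj (cong s i≡j)
... | tri> _ _ j<i = pairSums∉Range j<i ∘′ subst (Range s) (+-comm (s i) (s j))

lemma3p6 : (s : ℕ → ℕ) → (∀ i → 1 ≤ s i) → StrictlyIncreasing s →
    ((n : ℕ) → 2 ≤ n → (k : Fin n → ℕ) → (∀ {a b} → a Fin.< b → k a < k b) →
    ¬ Range s (sumF (λ t → s (k t)))) →
    IP<ω* (λ m → ¬ Range s m)
lemma3p6 s _ _ sums∉Range =
  distinctSumFree⇒∁-IP<ω* (range-distinctSumFree s (pairSumsOfTerms∉Range s sums∉Range))
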